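{- For every $\mathrm{IMLU}$-category $(\mathbf{M},\mathbf{N})$, the category $\mathbf{SCan}_{(\mathbf{M},\mathbf{N})}$ has power objects. More specifically, for each object $A$ of $\mathbf{SCan}_{(\mathbf{M},\mathbf{N})}$, the object $\mathbf{P}A$ together with $(\iota_A^{ -1}\times\mathrm{id}_{\mathbf{P}A})\circ m_{\subseteq^{\mathbf{T}}_A}:\subseteq^{\mathbf{T}}_A\rightarrowtail A\times\mathbf{P}A$ is a power object of $A$ in $\mathbf{SCan}_{(\mathbf{M},\mathbf{N})}$.
   Context: Heyting category: finite limits, images, covers stable under pullback, each subobject poset $\mathrm{Sub}(X)$ a join-semilattice, each pullback map $f^*$ preserving finite joins with adjoints $\exists_f\dashv f^*\dashv\forall_f$. An $\mathrm{IMLU}$-category is a pair $(\mathbf{M},\mathbf{N})$ of Heyting categories with $\mathbf{N}$ a conservative (isomorphism-reflecting) Heyting subcategory of $\mathbf{M}$ (inclusion preserves the Heyting structure), together with: an object $U$ of $\mathbf{N}$ such that every object of $\mathbf{N}$ has a mono in $\mathbf{N}$ into $U$; an endofunctor $\mathbf{T}$ of $\mathbf{M}$ restricting to an endofunctor of $\mathbf{N}$ and a natural isomorphism $\iota:\mathrm{id}_\mathbf{M}\to\mathbf{T}$; an endofunctor $\mathbf{P}$ of $\mathbf{N}$ such that for each object $A$ of $\mathbf{N}$ there is $m_{\subseteq^\mathbf{T}_A}:\subseteq^\mathbf{T}_A\to\mathbf{T}A\times\mathbf{P}A$ in $\mathbf{N}$, monic in $\mathbf{M}$, such that for each $r:R\to\mathbf{T}A\times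 B$ in $\mathbf{N}$ monic in $\mathbf{M}$ there is $\chi:B\to\mathbf{P}A$ in $\mathbf{N}$ which is the unique morphism of $\mathbf{M}$ for which $r$ is a pullback in $\mathbf{M}$ of $m_{\subseteq^\mathbf{T}_A}$ along $\mathrm{id}\times\chi$; and a natural isomorphism $\mu:\mathbf{P}\mathbf{T}\to\mathbf{T}\mathbf{P}$ on $\mathbf{N}$. An object $X$ of $\mathbf{N}$ is strongly Cantorian if $\iota_X$ is an isomorphism in $\mathbf{N}$. $\mathbf{SCan}_{(\mathbf{M},\mathbf{N})}$ is the full subcategory of $\mathbf{N}$ on strongly Cantorian objects. A power object of $A$ in a category $\mathbf{C}$ is an object $\mathbf{P}'A$ with a mono $m:\,\in_A\rightarrowtail A\times\mathbf{P}'A$ such that for every mono $r:R\rightarrowtail A\times B$ there is a unique $\chi:B\to\mathbf{P}'A$ such that $r$ is a pullback of $m$ along $\mathrm{id}\times\chi$. -}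

module Defs where

open import Level using (Level; _⊔_; suc)
open import Data.Product using (Σ; _×_; _,_; proj₁; proj₂)
open import Relation.Binary using (IsEquivalence)

record Category (o ℓ e : Level) : Set (suc (o ⊔ ℓ ⊔ e)) where
  infixr 9 _∘_
  infix  4 _≈_
  infixr 0 _⇒_
  field
    Obj   : Set o
    _⇒_   : Obj → Obj → Set ℓ
    _≈_   : ∀ {A B} → (A ⇒ B) → (A ⇒ B) → Set e
    id    : ∀ {A} → A ⇒ A
    _∘_   : ∀ {A B C} → (B ⇒ C) → (A ⇒ B) → (A ⇒ C)
    equiv : ∀ {A B} → IsEquivalence (_≈_ {A} {B})
    assoc : ∀ {A B C D} {f : A ⇒ B} {g : B ⇒ C} {h : C ⇒ D} →
            (h ∘ g) ∘ f ≈ h ∘ (g ∘ f)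
    identityˡ : ∀ {A B} {f : A ⇒ B} → id ∘ f ≈ f
    identityʳ : ∀ {A B} {f : A ⇒ B} → f ∘ id ≈ f
    ∘-resp-≈  : ∀ {A B C} {f h : B ⇒ C} {g i : A ⇒ B} →
                f ≈ h → g ≈ i → f ∘ g ≈ h ∘ i

module _ {o ℓ e : Level} (C : Category o ℓ e) where
  open Category C

  _⇔_ : ∀ {a b} → Set a → Set b → Set (a ⊔ b)
  P ⇔ Q = (P → Q) × (Q → P)

  Mono : ∀ {A B} → (A ⇒ B) → Set (o ⊔ ℓ ⊔ e)
  Mono {A} m = ∀ {Z} (g h : Z ⇒ A) → m ∘ g ≈ m ∘ h → g ≈ h

  IsIso : ∀ {A B} → (A ⇒ B) → Set (ℓ ⊔ e)
  IsIso {A} {B} f = Σ (B ⇒ A) λ g → (g ∘ f ≈ id) × (f ∘ g ≈ id)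

  IsTerminal : Obj → Set (o ⊔ ℓ ⊔ e)
  IsTerminal T = ∀ X → Σ (X ⇒ T) λ t → ∀ (t' : X ⇒ T) → t' ≈ t

  IsProduct : ∀ {A B X} → (X ⇒ A) → (X ⇒ B) → Set (o ⊔ ℓ ⊔ e)
  IsProduct {A} {B} {X} p₁ p₂ =
    ∀ {Z} (f : Z ⇒ A) (g : Z ⇒ B) →
      Σ (Z ⇒ X) λ h → ((p₁ ∘ h ≈ f) × (p₂ ∘ h ≈ g)) ×
        (∀ (h' : Z ⇒ X) → p₁ ∘ h' ≈ f → p₂ ∘ h' ≈ g → h' ≈ h)

  IsPullback : ∀ {X Y V W} → (X ⇒ V) → (Y ⇒ V) → (W ⇒ X) → (W ⇒ Y) →
               Set (o ⊔ ℓ ⊔ e)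
  IsPullback {X} {Y} {V} {W} f g p q =
    (f ∘ p ≈ g ∘ q) ×
    (∀ {Z} (a : Z ⇒ X) (b : Z ⇒ Y) → f ∘ a ≈ g ∘ b →
       Σ (Z ⇒ W) λ h → ((p ∘ h ≈ a) × (q ∘ h ≈ b)) ×
         (∀ (h' : Z ⇒ W) → p ∘ h' ≈ a → q ∘ h' ≈ b → h' ≈ h))

  IsCover : ∀ {A B} → (A ⇒ B) → Set (o ⊔ ℓ ⊔ e)
  IsCover {A} {B} f =
    ∀ {I} (g : A ⇒ I) (m : I ⇒ B) → Mono m → f ≈ m ∘ g → IsIso m

  record SubObj (X : Obj) : Set (o ⊔ ℓ ⊔ e) where
    constructor subobj
    field
      dom  : Obj
      arr  : dom ⇒ X
      mono : Mono arr

  _≤ₛ_ : ∀ {X} → SubObj X → SubObj X → Set (ℓ ⊔ e)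
  s ≤ₛ t = Σ (SubObj.dom s ⇒ SubObj.dom t) λ k →
             SubObj.arr t ∘ k ≈ SubObj.arr s

  IsBottomSub : ∀ {X} → SubObj X → Set (o ⊔ ℓ ⊔ e)
  IsBottomSub {X} b = ∀ (v : SubObj X) → b ≤ₛ v

  IsJoinSub : ∀ {X} → SubObj X → SubObj X → SubObj X → Set (o ⊔ ℓ ⊔ e)
  IsJoinSub {X} s t u =
    (s ≤ₛ u) × (t ≤ₛ u) × (∀ (v : SubObj X) → s ≤ₛ v → t ≤ₛ v → u ≤ₛ v)

  IsPullbackSub : ∀ {X Y} → (X ⇒ Y) → SubObj Y → SubObj X → Set (o ⊔ ℓ ⊔ e)
  IsPullbackSub f t s =
    Σ (SubObj.dom s ⇒ SubObj.dom t) λ q → IsPullback f (SubObj.arr t) (SubObj.arr s) q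

  -- s ≤ f* t , expressed without choosing a pullback
  _≤*[_]_ : ∀ {X Y} → SubObj X → (X ⇒ Y) → SubObj Y → Set (ℓ ⊔ e)
  s ≤*[ f ] t = Σ (SubObj.dom s ⇒ SubObj.dom t) λ k →
                  SubObj.arr t ∘ k ≈ f ∘ SubObj.arr s

  -- e is ∃_f s  (left adjoint of f* evaluated at s)
  IsExistsImage : ∀ {X Y} → (X ⇒ Y) → SubObj X → SubObj Y → Set (o ⊔ ℓ ⊔ e)
  IsExistsImage {X} {Y} f s ex = ∀ (t : SubObj Y) → (ex ≤ₛ t) ⇔ (s ≤*[ f ] t)

  -- a is ∀_f s  (right adjoint of f* evaluated at s)
  IsForallImage : ∀ {X Y} → (X ⇒ Y) → SubObj X → SubObj Y → Set (o ⊔ ℓ ⊔ e)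
  IsForallImage {X} {Y} f s a =
    ∀ (t : SubObj Y) (p : SubObj X) → IsPullbackSub f t p → (p ≤ₛ s) ⇔ (t ≤ₛ a)

  record IsHeyting : Set (o ⊔ ℓ ⊔ e) where
    field
      terminal : Σ Obj IsTerminal
      product  : ∀ A B → Σ Obj λ X → Σ (X ⇒ A) λ p₁ → Σ (X ⇒ B) λ p₂ →
                   IsProduct p₁ p₂
      pullback : ∀ {X Y V} (f : X ⇒ V) (g : Y ⇒ V) →
                   Σ Obj λ W → Σ (W ⇒ X) λ p → Σ (W ⇒ Y) λ q → IsPullback f g p q
      image    : ∀ {A B} (f : A ⇒ B) →
                   Σ Obj λ I → Σ (A ⇒ I) λ c → Σ (I ⇒ B) λ m →
                     IsCover c × Mono m × (f ≈ m ∘ c)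
      cover-stable : ∀ {X Y V W} (f : X ⇒ V) (g : Y ⇒ V) (p : W ⇒ X) (q : W ⇒ Y) →
                       IsPullback f g p q → IsCover g → IsCover p
      bottom   : ∀ X → Σ (SubObj X) IsBottomSub
      join     : ∀ {X} (s t : SubObj X) → Σ (SubObj X) (IsJoinSub s t)
      pull-bottom : ∀ {X Y} (f : X ⇒ Y) (b : SubObj Y) (p : SubObj X) →
                      IsBottomSub b → IsPullbackSub f b p → IsBottomSub p
      pull-join   : ∀ {X Y} (f : X ⇒ Y) (t₁ t₂ u : SubObj Y) (s₁ s₂ v : SubObj X) →
                      IsJoinSub t₁ t₂ u → IsPullbackSub f t₁ s₁ →
                      IsPullbackSub f t₂ s₂ → IsPullbackSub f u v →
                      IsJoinSub s₁ s₂ v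
      exists-adj : ∀ {X Y} (f : X ⇒ Y) (s : SubObj X) → Σ (SubObj Y) (IsExistsImage f s)
      forall-adj : ∀ {X Y} (f : X ⇒ Y) (s : SubObj X) → Σ (SubObj Y) (IsForallImage f s)

  -- The morphism r : R ⇒ Y is a pullback of m : E ⇒ X along id × χ,
  -- where (X , p₁ , p₂) is a product of A and P and (Y , q₁ , q₂) a product
  -- of A and B; id × χ is any k : Y ⇒ X with p₁ ∘ k ≈ q₁ , p₂ ∘ k ≈ χ ∘ q₂.
  PullbackAlongId× : ∀ {A P B X Y E R} (p₁ : X ⇒ A) (p₂ : X ⇒ P)
                       (q₁ : Y ⇒ A) (q₂ : Y ⇒ B) (m : E ⇒ X) (χ : B ⇒ P) (r : R ⇒ Y) →
                       Set (o ⊔ ℓ ⊔ e)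
  PullbackAlongId× {E = E} {R = R} p₁ p₂ q₁ q₂ m χ r =
    ∀ (k : _ ⇒ _) → p₁ ∘ k ≈ q₁ → p₂ ∘ k ≈ χ ∘ q₂ →
      Σ (R ⇒ E) λ g → IsPullback k m r g

  IsPowerObject : ∀ {A P E X} (p₁ : X ⇒ A) (p₂ : X ⇒ P) (m : E ⇒ X) → Set (o ⊔ ℓ ⊔ e)
  IsPowerObject {A} {P} {E} {X} p₁ p₂ m =
    IsProduct p₁ p₂ × Mono m ×
    (∀ {B Y R : Obj} (q₁ : Y ⇒ A) (q₂ : Y ⇒ B) → IsProduct q₁ q₂ →
       (r : R ⇒ Y) → Mono r →
       Σ (B ⇒ P) λ χ → PullbackAlongId× p₁ p₂ q₁ q₂ m χ r ×
         (∀ (χ' : B ⇒ P) → PullbackAlongId× p₁ p₂ q₁ q₂ m χ' r → χ' ≈ χ))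

record Functor {o ℓ e o' ℓ' e'} (C : Category o ℓ e) (D : Category o' ℓ' e')
       : Set (o ⊔ ℓ ⊔ e ⊔ o' ⊔ ℓ' ⊔ e') where
  private
    module C = Category C
    module D = Category D
  field
    F₀ : C.Obj → D.Obj
    F₁ : ∀ {A B} → A C.⇒ B → F₀ A D.⇒ F₀ B
    identity     : ∀ {A} → F₁ (C.id {A}) D.≈ D.id
    homomorphism : ∀ {A B C'} {f : A C.⇒ B} {g : B C.⇒ C'} →
                   F₁ (g C.∘ f) D.≈ F₁ g D.∘ F₁ f
    F-resp-≈     : ∀ {A B} {f g : A C.⇒ B} → f C.≈ g → F₁ f D.≈ F₁ g

record Subcategory {o ℓ e : Level} (C : Category o ℓ e) (p : Level) : Set (o ⊔ ℓ ⊔ e ⊔ suc p) where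
  open Category C
  field
    isObj  : Obj → Set p
    isHom  : ∀ {A B} → (A ⇒ B) → Set p
    id-closed : ∀ {A} → isObj A → isHom (id {A})
    ∘-closed  : ∀ {A B C'} {f : B ⇒ C'} {g : A ⇒ B} → isHom f → isHom g → isHom (f ∘ g)
    ≈-closed  : ∀ {A B} {f g : A ⇒ B} → f ≈ g → isHom f → isHom g

module _ {o ℓ e p : Level} {C : Category o ℓ e} where
  open Category C

  record SHom (S : Subcategory C p) (A B : Σ Obj (Subcategory.isObj S)) : Set (ℓ ⊔ p) where
    constructor _,ₕ_
    field
      arr : proj₁ A ⇒ proj₁ B
      inS : Subcategory.isHom S arr

  SubCat : Subcategory C p → Category (o ⊔ p) (ℓ ⊔ p) e
  SubCat S = record
    { Obj = Σ Obj isObj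
    ; _⇒_ = SHom S
    ; _≈_ = λ f g → SHom.arr f ≈ SHom.arr g
    ; id  = λ {A} → id ,ₕ id-closed (proj₂ A)
    ; _∘_ = λ f g → (SHom.arr f ∘ SHom.arr g) ,ₕ ∘-closed (SHom.inS f) (SHom.inS g)
    ; equiv = record { refl = IsEquivalence.refl equiv
                     ; sym = IsEquivalence.sym equiv
                     ; trans = IsEquivalence.trans equiv }
    ; assoc = assoc
    ; identityˡ = identityˡ
    ; identityʳ = identityʳ
    ; ∘-resp-≈ = ∘-resp-≈
    }
    where open Subcategory S

module _ {o ℓ e : Level} {C : Category o ℓ e} where
  open Category C

  FullSub : ∀ {q} → (Obj → Set q) → Category (o ⊔ q) ℓ e
  FullSub Q = record
    { Obj = Σ Obj Q
    ; _⇒_ = λ A B → proj₁ A ⇒ proj₁ B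
    ; _≈_ = _≈_
    ; id  = id
    ; _∘_ = _∘_
    ; equiv = equiv
    ; assoc = assoc
    ; identityˡ = identityˡ
    ; identityʳ = identityʳ
    ; ∘-resp-≈ = ∘-resp-≈
    }

module _ {o ℓ e p : Level} {C : Category o ℓ e} where
  open Category C

  restrict : (S : Subcategory C p) (T : Functor C C) →
             (∀ {X} → Subcategory.isObj S X → Subcategory.isObj S (Functor.F₀ T X)) →
             (∀ {A B} {f : A ⇒ B} → Subcategory.isHom S f → Subcategory.isHom S (Functor.F₁ T f)) →
             Functor (SubCat S) (SubCat S)
  restrict S T to th = record
    { F₀ = λ X → F₀ (proj₁ X) , to (proj₂ X)
    ; F₁ = λ f → F₁ (SHom.arr f) ,ₕ th (SHom.inS f)
    ; identity = identity
    ; homomorphism = homomorphism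
    ; F-resp-≈ = F-resp-≈
    }
    where open Functor T

record IMLU (o ℓ e p : Level) : Set (suc (o ⊔ ℓ ⊔ e ⊔ p)) where
  field
    M : Category o ℓ e
    M-heyting : IsHeyting M
    Nsub : Subcategory M p

  N : Category (o ⊔ p) (ℓ ⊔ p) e
  N = SubCat Nsub

  private
    module M = Category M
    module N = Category N
  open Subcategory Nsub public

  field
    N-heyting : IsHeyting N
    conservative : ∀ {A B : N.Obj} (f : A N.⇒ B) → IsIso M (SHom.arr f) → IsIso N f
    pres-mono     : ∀ {A B : N.Obj} (f : A N.⇒ B) → Mono N f → Mono M (SHom.arr f)
    pres-terminal : ∀ (X : N.Obj) → IsTerminal N X → IsTerminal M (proj₁ X)
    pres-product  : ∀ {A B X : N.Obj} (p₁ : X N.⇒ A) (p₂ : X N.⇒ B) →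
                      IsProduct N p₁ p₂ → IsProduct M (SHom.arr p₁) (SHom.arr p₂)
    pres-pullback : ∀ {X Y V W : N.Obj} (f : X N.⇒ V) (g : Y N.⇒ V) (a : W N.⇒ X) (b : W N.⇒ Y) →
                      IsPullback N f g a b → IsPullback M (SHom.arr f) (SHom.arr g) (SHom.arr a) (SHom.arr b)
    pres-cover    : ∀ {A B : N.Obj} (f : A N.⇒ B) → IsCover N f → IsCover M (SHom.arr f)

  incSub : ∀ {X : N.Obj} → SubObj N X → SubObj M (proj₁ X)
  incSub s = subobj (proj₁ (SubObj.dom s)) (SHom.arr (SubObj.arr s))
                    (pres-mono (SubObj.arr s) (SubObj.mono s))

  field
    pres-bottom : ∀ {X : N.Obj} (b : SubObj N X) → IsBottomSub N b → IsBottomSub M (incSub b)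
    pres-join   : ∀ {X : N.Obj} (s t u : SubObj N X) → IsJoinSub N s t u →
                    IsJoinSub M (incSub s) (incSub t) (incSub u)
    pres-exists : ∀ {X Y : N.Obj} (f : X N.⇒ Y) (s : SubObj N X) (ex : SubObj N Y) →
                    IsExistsImage N f s ex → IsExistsImage M (SHom.arr f) (incSub s) (incSub ex)
    pres-forall : ∀ {X Y : N.Obj} (f : X N.⇒ Y) (s : SubObj N X) (a : SubObj N Y) →
                    IsForallImage N f s a → IsForallImage M (SHom.arr f) (incSub s) (incSub a)

  _×N_ : N.Obj → N.Obj → N.Obj
  A ×N B = proj₁ (IsHeyting.product N-heyting A B)

  π₁N : ∀ {A B} → (A ×N B) N.⇒ A
  π₁N {A} {B} = proj₁ (proj₂ (IsHeyting.product N-heyting A B))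

  π₂N : ∀ {A B} → (A ×N B) N.⇒ B
  π₂N {A} {B} = proj₁ (proj₂ (proj₂ (IsHeyting.product N-heyting A B)))

  field
    U     : N.Obj
    U-emb : ∀ (X : N.Obj) → Σ (X N.⇒ U) (Mono N)
    T     : Functor M M
    T-obj : ∀ {X} → isObj X → isObj (Functor.F₀ T X)
    T-hom : ∀ {A B} {f : A M.⇒ B} → isHom f → isHom (Functor.F₁ T f)
    ι     : ∀ X → X M.⇒ Functor.F₀ T X
    ι-natural : ∀ {X Y} (f : X M.⇒ Y) → Functor.F₁ T f M.∘ ι X M.≈ ι Y M.∘ f
    ι-iso : ∀ X → IsIso M (ι X)

  TN : Functor N N
  TN = restrict Nsub T T-obj T-hom

  field
    P : Functor N N
    ⊆T : N.Obj → N.Obj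
    m⊆ : ∀ (A : N.Obj) → ⊆T A N.⇒ (Functor.F₀ TN A ×N Functor.F₀ P A)
    m⊆-mono : ∀ (A : N.Obj) → Mono M (SHom.arr (m⊆ A))
    m⊆-universal :
      ∀ (A B R : N.Obj) (r : R N.⇒ (Functor.F₀ TN A ×N B)) → Mono M (SHom.arr r) →
        Σ (B N.⇒ Functor.F₀ P A) λ χ →
          PullbackAlongId× M (SHom.arr (π₁N {Functor.F₀ TN A} {Functor.F₀ P A}))
                             (SHom.arr (π₂N {Functor.F₀ TN A} {Functor.F₀ P A}))
                             (SHom.arr (π₁N {Functor.F₀ TN A} {B}))
                             (SHom.arr (π₂N {Functor.F₀ TN A} {B}))
                             (SHom.arr (m⊆ A)) (SHom.arr χ) (SHom.arr r) ×
          (∀ (χ' : proj₁ B M.⇒ proj₁ (Functor.F₀ P A)) →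
            PullbackAlongId× M (SHom.arr (π₁N {Functor.F₀ TN A} {Functor.F₀ P A}))
                               (SHom.arr (π₂N {Functor.F₀ TN A} {Functor.F₀ P A}))
                               (SHom.arr (π₁N {Functor.F₀ TN A} {B}))
                               (SHom.arr (π₂N {Functor.F₀ TN A} {B}))
                               (SHom.arr (m⊆ A)) χ' (SHom.arr r) →
            χ' M.≈ SHom.arr χ)
    μ : ∀ (A : N.Obj) → Functor.F₀ P (Functor.F₀ TN A) N.⇒ Functor.F₀ TN (Functor.F₀ P A)
    μ-natural : ∀ {A B : N.Obj} (f : A N.⇒ B) →
                  Functor.F₁ TN (Functor.F₁ P f) N.∘ μ A N.≈ μ B N.∘ Functor.F₁ P (Functor.F₁ TN f)
    μ-iso : ∀ (A : N.Obj) → IsIso N (μ A)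

  isSCan : N.Obj → Set (ℓ ⊔ e ⊔ p)
  isSCan X = Σ (isHom (ι (proj₁ X))) λ h →
               IsIso N {X} {Functor.F₀ TN X} (ι (proj₁ X) ,ₕ h)

  SCan : Category (o ⊔ ℓ ⊔ e ⊔ p) (ℓ ⊔ p) e
  SCan = FullSub {C = N} isSCan

module Submission where

-- Idea: on strongly Cantorian objects ι is an isomorphism inside N, so A ≅ TA,
-- and m, which classifies N-relations R ↣ TA × B, becomes a membership relation
-- for A.  One has to check that all objects involved are strongly Cantorian and
-- that monos and pullbacks of SCan agree with those of M well enough to carry
-- the universal property of m over to SCan.

open import Defs
open import Data.Product using (Σ; _,_; proj₁; proj₂; _×_)
open import Level using (Level; _⊔_)
open import Relation.Binary using (Setoid; IsEquivalence)
import Relation.Binary.Reasoning.Setoid as SetoidReasoning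

module CategoryFacts {o ℓ e : Level} (C : Category o ℓ e) where
  open Category C

  module _ {X Y : Obj} where
    open IsEquivalence (equiv {X} {Y}) public
      using () renaming (refl to ≈-refl; sym to ≈-sym; trans to ≈-trans)

  hom-setoid : ∀ {X Y : Obj} → Setoid ℓ e
  hom-setoid {X} {Y} = record { Carrier = X ⇒ Y ; _≈_ = _≈_ ; isEquivalence = equiv }

  module HomReasoning {X Y : Obj} = SetoidReasoning (hom-setoid {X} {Y})
  open HomReasoning public

  infixr 4 refl⟩∘⟨_ _⟩∘⟨refl

  refl⟩∘⟨_ : ∀ {X Y Z} {f : Y ⇒ Z} {g h : X ⇒ Y} → g ≈ h → f ∘ g ≈ f ∘ h
  refl⟩∘⟨ g≈h = ∘-resp-≈ ≈-refl g≈h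

  _⟩∘⟨refl : ∀ {X Y Z} {f g : Y ⇒ Z} {h : X ⇒ Y} → f ≈ g → f ∘ h ≈ g ∘ h
  f≈g ⟩∘⟨refl = ∘-resp-≈ f≈g ≈-refl

  sym-assoc : ∀ {X Y Z W} {f : X ⇒ Y} {g : Y ⇒ Z} {h : Z ⇒ W} →
              h ∘ (g ∘ f) ≈ (h ∘ g) ∘ f
  sym-assoc = ≈-sym assoc

  cancelˡ : ∀ {X Y Z} {f : Y ⇒ Z} {g : Z ⇒ Y} {h : X ⇒ Y} →
            g ∘ f ≈ id → g ∘ (f ∘ h) ≈ h
  cancelˡ {f = f} {g} {h} g∘f≈id = begin
    g ∘ (f ∘ h)  ≈⟨ sym-assoc ⟩
    (g ∘ f) ∘ h  ≈⟨ g∘f≈id ⟩∘⟨refl ⟩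
    id ∘ h       ≈⟨ identityˡ ⟩
    h            ∎

  factor-equalises : ∀ {X Y Z W} {u : W ⇒ X} {p : X ⇒ Y} {f : W ⇒ Y} {x y : Z ⇒ W} →
                     p ∘ u ≈ f → u ∘ x ≈ u ∘ y → f ∘ x ≈ f ∘ y
  factor-equalises {u = u} {p} {f} {x} {y} p∘u≈f u∘x≈u∘y = begin
    f ∘ x        ≈⟨ p∘u≈f ⟩∘⟨refl ⟨
    (p ∘ u) ∘ x  ≈⟨ assoc ⟩
    p ∘ (u ∘ x)  ≈⟨ refl⟩∘⟨ u∘x≈u∘y ⟩
    p ∘ (u ∘ y)  ≈⟨ sym-assoc ⟩
    (p ∘ u) ∘ y  ≈⟨ p∘u≈f ⟩∘⟨refl ⟩
    f ∘ y        ∎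

  iso-shift : ∀ {X Y Z} {f : Y ⇒ Z} {θ : X ⇒ Y} {θ⁻¹ : Y ⇒ X} {g : X ⇒ Z} →
              f ∘ θ ≈ g → θ ∘ θ⁻¹ ≈ id → f ≈ g ∘ θ⁻¹
  iso-shift {f = f} {θ} {θ⁻¹} {g} f∘θ≈g θ∘θ⁻¹≈id = begin
    f               ≈⟨ identityʳ ⟨
    f ∘ id          ≈⟨ refl⟩∘⟨ θ∘θ⁻¹≈id ⟨
    f ∘ (θ ∘ θ⁻¹)   ≈⟨ sym-assoc ⟩
    (f ∘ θ) ∘ θ⁻¹   ≈⟨ f∘θ≈g ⟩∘⟨refl ⟩
    g ∘ θ⁻¹         ∎

  left-inverse-unique : ∀ {X Y} {f : X ⇒ Y} {g : Y ⇒ X} (i : IsIso C f) →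
                        g ∘ f ≈ id → g ≈ proj₁ i
  left-inverse-unique (_ , _ , f∘f⁻¹≈id) g∘f≈id =
    ≈-trans (iso-shift g∘f≈id f∘f⁻¹≈id) identityˡ

  section⇒mono : ∀ {X Y} {f : X ⇒ Y} {g : Y ⇒ X} → g ∘ f ≈ id → Mono C f
  section⇒mono {f = f} {g} g∘f≈id x y f∘x≈f∘y = begin
    x            ≈⟨ cancelˡ g∘f≈id ⟨
    g ∘ (f ∘ x)  ≈⟨ refl⟩∘⟨ f∘x≈f∘y ⟩
    g ∘ (f ∘ y)  ≈⟨ cancelˡ g∘f≈id ⟩
    y            ∎

  mono-resp-≈ : ∀ {X Y} {f g : X ⇒ Y} → f ≈ g → Mono C f → Mono C g
  mono-resp-≈ f≈g f-mono x y g∘x≈g∘y =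
    f-mono x y (≈-trans (f≈g ⟩∘⟨refl) (≈-trans g∘x≈g∘y (≈-sym (f≈g ⟩∘⟨refl))))

  mono-∘ : ∀ {X Y Z} {f : Y ⇒ Z} {g : X ⇒ Y} → Mono C f → Mono C g → Mono C (f ∘ g)
  mono-∘ f-mono g-mono x y fg∘x≈fg∘y =
    g-mono x y (f-mono _ _ (≈-trans sym-assoc (≈-trans fg∘x≈fg∘y assoc)))

  mono-factor : ∀ {X Y Z} {f : Y ⇒ Z} {g : X ⇒ Y} {h : X ⇒ Z} →
                f ∘ g ≈ h → Mono C h → Mono C g
  mono-factor f∘g≈h h-mono x y g∘x≈g∘y = h-mono x y (factor-equalises f∘g≈h g∘x≈g∘y)

  JointlyMonic : ∀ {X Y W} → W ⇒ X → W ⇒ Y → Set (o ⊔ ℓ ⊔ e)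
  JointlyMonic {W = W} p q =
    ∀ {Z} (x y : Z ⇒ W) → p ∘ x ≈ p ∘ y → q ∘ x ≈ q ∘ y → x ≈ y

  jointly-monic-components : ∀ {X Y Z W} {p₁ : X ⇒ Y} {p₂ : X ⇒ Z} {u : W ⇒ X}
                               {f : W ⇒ Y} {g : W ⇒ Z} →
                             p₁ ∘ u ≈ f → p₂ ∘ u ≈ g → JointlyMonic f g → Mono C u
  jointly-monic-components p₁∘u≈f p₂∘u≈g f,g-monic x y u∘x≈u∘y =
    f,g-monic x y (factor-equalises p₁∘u≈f u∘x≈u∘y) (factor-equalises p₂∘u≈g u∘x≈u∘y)

  product-ext : ∀ {X Y Z} {p₁ : X ⇒ Y} {p₂ : X ⇒ Z} → IsProduct C p₁ p₂ → JointlyMonic p₁ p₂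
  product-ext {p₁ = p₁} {p₂} product x y p₁∘x≈p₁∘y p₂∘x≈p₂∘y =
    let (_ , _ , unique) = product (p₁ ∘ x) (p₂ ∘ x)
    in ≈-trans (unique x ≈-refl ≈-refl) (≈-sym (unique y (≈-sym p₁∘x≈p₁∘y) (≈-sym p₂∘x≈p₂∘y)))

  component-inverse : ∀ {X X' Y Y'} {p : X ⇒ Y} {p' : X' ⇒ Y'} {k : X ⇒ X'} {k' : X' ⇒ X}
                        {θ : Y ⇒ Y'} {θ' : Y' ⇒ Y} →
                      p' ∘ k ≈ θ ∘ p → p ∘ k' ≈ θ' ∘ p' → θ' ∘ θ ≈ id →
                      p ∘ (k' ∘ k) ≈ p ∘ id
  component-inverse {p = p} {p'} {k} {k'} {θ} {θ'} p'∘k≈θ∘p p∘k'≈θ'∘p' θ'∘θ≈id = begin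
    p ∘ (k' ∘ k)      ≈⟨ sym-assoc ⟩
    (p ∘ k') ∘ k      ≈⟨ p∘k'≈θ'∘p' ⟩∘⟨refl ⟩
    (θ' ∘ p') ∘ k     ≈⟨ assoc ⟩
    θ' ∘ (p' ∘ k)     ≈⟨ refl⟩∘⟨ p'∘k≈θ∘p ⟩
    θ' ∘ (θ ∘ p)      ≈⟨ cancelˡ θ'∘θ≈id ⟩
    p                 ≈⟨ identityʳ ⟨
    p ∘ id            ∎

  product-maps-inverse :
    ∀ {X X' Y Y' Z Z'} {p₁ : X ⇒ Y} {p₂ : X ⇒ Z} {p₁' : X' ⇒ Y'} {p₂' : X' ⇒ Z'}
      {k : X ⇒ X'} {k' : X' ⇒ X} {θ₁ : Y ⇒ Y'} {θ₂ : Z ⇒ Z'} {θ₁' : Y' ⇒ Y} {θ₂' : Z' ⇒ Z} →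
    JointlyMonic p₁ p₂ →
    p₁' ∘ k ≈ θ₁ ∘ p₁ → p₂' ∘ k ≈ θ₂ ∘ p₂ →
    p₁ ∘ k' ≈ θ₁' ∘ p₁' → p₂ ∘ k' ≈ θ₂' ∘ p₂' →
    θ₁' ∘ θ₁ ≈ id → θ₂' ∘ θ₂ ≈ id → k' ∘ k ≈ id
  product-maps-inverse p₁,p₂-monic k₁ k₂ k'₁ k'₂ θ₁ θ₂ =
    p₁,p₂-monic _ _ (component-inverse k₁ k'₁ θ₁) (component-inverse k₂ k'₂ θ₂)

  pullback-jointly-monic : ∀ {X Y V W} {f : X ⇒ V} {g : Y ⇒ V} {p : W ⇒ X} {q : W ⇒ Y} →
                           IsPullback C f g p q → JointlyMonic p q
  pullback-jointly-monic {f = f} {g} {p} {q} (f∘p≈g∘q , universal) x y p∘x≈p∘y q∘x≈q∘y =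
    let (_ , _ , unique) = universal (p ∘ x) (q ∘ x) cone
    in ≈-trans (unique x ≈-refl ≈-refl) (≈-sym (unique y (≈-sym p∘x≈p∘y) (≈-sym q∘x≈q∘y)))
    where
    cone : f ∘ (p ∘ x) ≈ g ∘ (q ∘ x)
    cone = ≈-trans sym-assoc (≈-trans (f∘p≈g∘q ⟩∘⟨refl) assoc)

  iso-square-pullback : ∀ {X Y V W} {f : X ⇒ V} {g : Y ⇒ V} {p : W ⇒ X} {q : W ⇒ Y}
                          {q⁻¹ : Y ⇒ W} →
                        Mono C f → q⁻¹ ∘ q ≈ id → q ∘ q⁻¹ ≈ id → f ∘ p ≈ g ∘ q →
                        IsPullback C f g p q
  iso-square-pullback {X} {Y} {f = f} {g} {p} {q} {q⁻¹} f-mono q⁻¹∘q≈id q∘q⁻¹≈id f∘p≈g∘q =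
    f∘p≈g∘q , λ a b f∘a≈g∘b →
      (q⁻¹ ∘ b) , (f-mono _ _ (p-leg a b f∘a≈g∘b) , cancelˡ q∘q⁻¹≈id) ,
      λ h _ q∘h≈b → ≈-trans (≈-sym (cancelˡ q⁻¹∘q≈id)) (refl⟩∘⟨ q∘h≈b)
    where
    p-leg : ∀ {Z} (a : Z ⇒ X) (b : Z ⇒ Y) → f ∘ a ≈ g ∘ b → f ∘ (p ∘ (q⁻¹ ∘ b)) ≈ f ∘ a
    p-leg a b f∘a≈g∘b = begin
      f ∘ (p ∘ (q⁻¹ ∘ b))   ≈⟨ sym-assoc ⟩
      (f ∘ p) ∘ (q⁻¹ ∘ b)   ≈⟨ f∘p≈g∘q ⟩∘⟨refl ⟩
      (g ∘ q) ∘ (q⁻¹ ∘ b)   ≈⟨ assoc ⟩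
      g ∘ (q ∘ (q⁻¹ ∘ b))   ≈⟨ refl⟩∘⟨ cancelˡ q∘q⁻¹≈id ⟩
      g ∘ b                 ≈⟨ f∘a≈g∘b ⟨
      f ∘ a                 ∎

  module _ {X X' Y V V'} {f : X ⇒ V} {g : Y ⇒ V} {f' : X' ⇒ V'} {g' : Y ⇒ V'}
           {φ : X ⇒ X'} {φ⁻¹ : X' ⇒ X} {ψ : V ⇒ V'}
           (φ⁻¹∘φ≈id : φ⁻¹ ∘ φ ≈ id) (φ∘φ⁻¹≈id : φ ∘ φ⁻¹ ≈ id) (ψ-mono : Mono C ψ)
           (f'∘φ≈ψ∘f : f' ∘ φ ≈ ψ ∘ f) (g'≈ψ∘g : g' ≈ ψ ∘ g) where

    private
      cone-to : ∀ {Z} {x : Z ⇒ X} {y : Z ⇒ Y} → f ∘ x ≈ g ∘ y → f' ∘ (φ ∘ x) ≈ g' ∘ y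
      cone-to {x = x} {y} f∘x≈g∘y = begin
        f' ∘ (φ ∘ x)   ≈⟨ sym-assoc ⟩
        (f' ∘ φ) ∘ x   ≈⟨ f'∘φ≈ψ∘f ⟩∘⟨refl ⟩
        (ψ ∘ f) ∘ x    ≈⟨ assoc ⟩
        ψ ∘ (f ∘ x)    ≈⟨ refl⟩∘⟨ f∘x≈g∘y ⟩
        ψ ∘ (g ∘ y)    ≈⟨ sym-assoc ⟩
        (ψ ∘ g) ∘ y    ≈⟨ g'≈ψ∘g ⟩∘⟨refl ⟨
        g' ∘ y         ∎

      cone-from : ∀ {Z} {x : Z ⇒ X} {y : Z ⇒ Y} → f' ∘ (φ ∘ x) ≈ g' ∘ y → f ∘ x ≈ g ∘ y
      cone-from {x = x} {y} f'∘φx≈g'∘y = ψ-mono _ _ (begin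
        ψ ∘ (f ∘ x)    ≈⟨ sym-assoc ⟩
        (ψ ∘ f) ∘ x    ≈⟨ f'∘φ≈ψ∘f ⟩∘⟨refl ⟨
        (f' ∘ φ) ∘ x   ≈⟨ assoc ⟩
        f' ∘ (φ ∘ x)   ≈⟨ f'∘φx≈g'∘y ⟩
        g' ∘ y         ≈⟨ g'≈ψ∘g ⟩∘⟨refl ⟩
        (ψ ∘ g) ∘ y    ≈⟨ assoc ⟩
        ψ ∘ (g ∘ y)    ∎)

      φ-mono : Mono C φ
      φ-mono = section⇒mono φ⁻¹∘φ≈id

    pullback-transport : ∀ {W} {p : W ⇒ X} {q : W ⇒ Y} →
                         IsPullback C f g p q → IsPullback C f' g' (φ ∘ p) q
    pullback-transport {p = p} {q} (f∘p≈g∘q , universal) =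
      cone-to f∘p≈g∘q , λ a b f'∘a≈g'∘b →
        let (h , (p∘h≈φ⁻¹a , q∘h≈b) , unique) =
              universal (φ⁻¹ ∘ a) b (cone-from (≈-trans (refl⟩∘⟨ cancelˡ φ∘φ⁻¹≈id) f'∘a≈g'∘b))
        in h ,
           (≈-trans assoc (≈-trans (refl⟩∘⟨ p∘h≈φ⁻¹a) (cancelˡ φ∘φ⁻¹≈id)) , q∘h≈b) ,
           λ h' φp∘h'≈a q∘h'≈b →
             unique h' (≈-trans (≈-sym (cancelˡ φ⁻¹∘φ≈id))
                                (refl⟩∘⟨ ≈-trans sym-assoc φp∘h'≈a)) q∘h'≈b

    pullback-untransport : ∀ {W} {p : W ⇒ X} {q : W ⇒ Y} →
                           IsPullback C f' g' (φ ∘ p) q → IsPullback C f g p q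
    pullback-untransport {p = p} {q} (f'∘φp≈g'∘q , universal) =
      cone-from f'∘φp≈g'∘q ,
      λ a b f∘a≈g∘b →
        let (h , (φp∘h≈φa , q∘h≈b) , unique) = universal (φ ∘ a) b (cone-to f∘a≈g∘b)
        in h , (φ-mono _ _ (≈-trans sym-assoc φp∘h≈φa) , q∘h≈b) ,
           λ h' p∘h'≈a q∘h'≈b → unique h' (≈-trans assoc (refl⟩∘⟨ p∘h'≈a)) q∘h'≈b

module IMLUFacts {o ℓ e p : Level} (I : IMLU o ℓ e p) where
  open IMLU I
  open Category M
  open CategoryFacts M

  private
    module S = CategoryFacts SCan

  NObj : Set (o ⊔ p)
  NObj = Category.Obj N

  infixr 0 _⇒N_ _⇒S_
  infixr 9 _∘N_

  _⇒N_ : NObj → NObj → Set (ℓ ⊔ p)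
  _⇒N_ = Category._⇒_ N

  _∘N_ : ∀ {X Y Z : NObj} → Y ⇒N Z → X ⇒N Y → X ⇒N Z
  _∘N_ = Category._∘_ N

  SObj : Set (o ⊔ ℓ ⊔ e ⊔ p)
  SObj = Category.Obj SCan

  _⇒S_ : SObj → SObj → Set (ℓ ⊔ p)
  _⇒S_ = Category._⇒_ SCan

  arr : ∀ {X Y : NObj} → X ⇒N Y → proj₁ X ⇒ proj₁ Y
  arr = SHom.arr

  N-iso⇒M-iso : ∀ {X Y : NObj} {f : X ⇒N Y} → IsIso N f → IsIso M (arr f)
  N-iso⇒M-iso (g , g∘f≈id , f∘g≈id) = arr g , g∘f≈id , f∘g≈id

  T₁ : ∀ {X Y : Obj} → X ⇒ Y → Functor.F₀ T X ⇒ Functor.F₀ T Y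
  T₁ = Functor.F₁ T

  TN₀ : NObj → NObj
  TN₀ = Functor.F₀ TN

  TN₁ : ∀ {X Y : NObj} → X ⇒N Y → TN₀ X ⇒N TN₀ Y
  TN₁ = Functor.F₁ TN

  P₀ : NObj → NObj
  P₀ = Functor.F₀ P

  ι⁻¹ : ∀ X → Functor.F₀ T X ⇒ X
  ι⁻¹ X = proj₁ (ι-iso X)

  ι⁻¹∘ι : ∀ X → ι⁻¹ X ∘ ι X ≈ id
  ι⁻¹∘ι X = proj₁ (proj₂ (ι-iso X))

  ι∘ι⁻¹ : ∀ X → ι X ∘ ι⁻¹ X ≈ id
  ι∘ι⁻¹ X = proj₂ (proj₂ (ι-iso X))

  π₁ : ∀ {X Y : NObj} → proj₁ (X ×N Y) ⇒ proj₁ X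
  π₁ {X} {Y} = arr (π₁N {X} {Y})

  π₂ : ∀ {X Y : NObj} → proj₁ (X ×N Y) ⇒ proj₁ Y
  π₂ {X} {Y} = arr (π₂N {X} {Y})

  productN : ∀ (X Y : NObj) → IsProduct N (π₁N {X} {Y}) (π₂N {X} {Y})
  productN X Y = proj₂ (proj₂ (proj₂ (IsHeyting.product N-heyting X Y)))

  productM : ∀ (X Y : NObj) → IsProduct M (π₁ {X} {Y}) (π₂ {X} {Y})
  productM X Y = pres-product π₁N π₂N (productN X Y)

  ×-ext : ∀ {X Y : NObj} → JointlyMonic (π₁ {X} {Y}) (π₂ {X} {Y})
  ×-ext {X} {Y} = product-ext (productM X Y)

  ⟨_,_⟩N : ∀ {X Y Z : NObj} → Z ⇒N X → Z ⇒N Y → Z ⇒N (X ×N Y)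
  ⟨_,_⟩N {X} {Y} f g = proj₁ (productN X Y f g)

  π₁∘⟨⟩N : ∀ {X Y Z : NObj} (f : Z ⇒N X) (g : Z ⇒N Y) → π₁ {X} {Y} ∘ arr ⟨ f , g ⟩N ≈ arr f
  π₁∘⟨⟩N {X} {Y} f g = proj₁ (proj₁ (proj₂ (productN X Y f g)))

  π₂∘⟨⟩N : ∀ {X Y Z : NObj} (f : Z ⇒N X) (g : Z ⇒N Y) → π₂ {X} {Y} ∘ arr ⟨ f , g ⟩N ≈ arr g
  π₂∘⟨⟩N {X} {Y} f g = proj₂ (proj₁ (proj₂ (productN X Y f g)))

  ⟨_,_⟩M : ∀ {X Y : NObj} {Z : Obj} → Z ⇒ proj₁ X → Z ⇒ proj₁ Y → Z ⇒ proj₁ (X ×N Y)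
  ⟨_,_⟩M {X} {Y} f g = proj₁ (productM X Y f g)

  π₁∘⟨⟩M : ∀ {X Y : NObj} {Z : Obj} (f : Z ⇒ proj₁ X) (g : Z ⇒ proj₁ Y) →
           π₁ {X} {Y} ∘ ⟨ f , g ⟩M ≈ f
  π₁∘⟨⟩M {X} {Y} f g = proj₁ (proj₁ (proj₂ (productM X Y f g)))

  π₂∘⟨⟩M : ∀ {X Y : NObj} {Z : Obj} (f : Z ⇒ proj₁ X) (g : Z ⇒ proj₁ Y) →
           π₂ {X} {Y} ∘ ⟨ f , g ⟩M ≈ g
  π₂∘⟨⟩M {X} {Y} f g = proj₂ (proj₁ (proj₂ (productM X Y f g)))

  module NPullback {X Y V : NObj} (f : X ⇒N V) (g : Y ⇒N V) where
    W : NObj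
    W = proj₁ (IsHeyting.pullback N-heyting f g)

    w₁ : W ⇒N X
    w₁ = proj₁ (proj₂ (IsHeyting.pullback N-heyting f g))

    w₂ : W ⇒N Y
    w₂ = proj₁ (proj₂ (proj₂ (IsHeyting.pullback N-heyting f g)))

    isPullbackM : IsPullback M (arr f) (arr g) (arr w₁) (arr w₂)
    isPullbackM = pres-pullback f g w₁ w₂ (proj₂ (proj₂ (proj₂ (IsHeyting.pullback N-heyting f g))))

  -- If an M-morphism v becomes an N-morphism after composing with an
  -- M-monic N-morphism n, then v is itself in N: the pullback leg w₁ of n
  -- along n ∘ v is an iso in M, hence (conservativity) in N, and v is the
  -- other leg w₂ composed with the inverse of w₁.
  factor : ∀ {S X Z : NObj} (n : S ⇒N X) (f : Z ⇒N X) → Mono M (arr n) →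
           (v : proj₁ Z ⇒ proj₁ S) → arr f ≈ arr n ∘ v → isHom v
  factor {Z = Z} n f n-mono v f≈n∘v =
    let (s , (w₁∘s≈id , w₂∘s≈v) , _) = proj₂ isPullbackM id v (≈-trans identityʳ f≈n∘v)
        w₁-isoN : IsIso N {W} {Z} w₁
        w₁-isoN = conservative w₁ (s , retraction w₁∘s≈id w₂∘s≈v , w₁∘s≈id)
        s≈w₁⁻¹ : s ≈ arr (proj₁ w₁-isoN)
        s≈w₁⁻¹ = left-inverse-unique (N-iso⇒M-iso {f = w₁} w₁-isoN) (retraction w₁∘s≈id w₂∘s≈v)
    in ≈-closed (≈-trans (refl⟩∘⟨ ≈-sym s≈w₁⁻¹) w₂∘s≈v) (SHom.inS (w₂ ∘N proj₁ w₁-isoN))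
    where
    open NPullback f n

    v∘w₁≈w₂ : v ∘ arr w₁ ≈ arr w₂
    v∘w₁≈w₂ = n-mono _ _ (begin
      arr n ∘ (v ∘ arr w₁)   ≈⟨ sym-assoc ⟩
      (arr n ∘ v) ∘ arr w₁   ≈⟨ f≈n∘v ⟩∘⟨refl ⟨
      arr f ∘ arr w₁         ≈⟨ proj₁ isPullbackM ⟩
      arr n ∘ arr w₂         ∎)

    retraction : ∀ {s : proj₁ Z ⇒ proj₁ W} → arr w₁ ∘ s ≈ id → arr w₂ ∘ s ≈ v →
                 s ∘ arr w₁ ≈ id
    retraction {s} w₁∘s≈id w₂∘s≈v = pullback-jointly-monic isPullbackM _ _
      (≈-trans sym-assoc (≈-trans (w₁∘s≈id ⟩∘⟨refl) (≈-trans identityˡ (≈-sym identityʳ))))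
      (≈-trans sym-assoc (≈-trans (w₂∘s≈v ⟩∘⟨refl) (≈-trans v∘w₁≈w₂ (≈-sym identityʳ))))

  ι⁻¹N : ∀ {X : NObj} → isSCan X → TN₀ X ⇒N X
  ι⁻¹N sX = proj₁ (proj₂ sX)

  ιN : ∀ {X : NObj} → isSCan X → X ⇒N TN₀ X
  ιN {X} sX = ι (proj₁ X) ,ₕ proj₁ sX

  ι⁻¹N∘ι : ∀ {X : NObj} (sX : isSCan X) → arr (ι⁻¹N sX) ∘ ι (proj₁ X) ≈ id
  ι⁻¹N∘ι sX = proj₁ (proj₂ (proj₂ sX))

  ι∘ι⁻¹N : ∀ {X : NObj} (sX : isSCan X) → ι (proj₁ X) ∘ arr (ι⁻¹N sX) ≈ id
  ι∘ι⁻¹N sX = proj₂ (proj₂ (proj₂ sX))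

  ι⁻¹N∘T∘ι : ∀ {X : NObj} {Z : Obj} (sX : isSCan X) (f : Z ⇒ proj₁ X) →
             (arr (ι⁻¹N sX) ∘ T₁ f) ∘ ι Z ≈ f
  ι⁻¹N∘T∘ι sX f = ≈-trans assoc (≈-trans (refl⟩∘⟨ ι-natural f) (cancelˡ (ι⁻¹N∘ι sX)))

  -- X is strongly Cantorian as soon as ι_X has a left inverse in N: that
  -- left inverse is the M-inverse of ι_X, so by conservativity it is
  -- invertible in N, and its N-inverse is ι_X.
  scan-from-retraction : ∀ (X : NObj) (q : TN₀ X ⇒N X) → arr q ∘ ι (proj₁ X) ≈ id → isSCan X
  scan-from-retraction X q q∘ι≈id = ι∈N , q , q∘ι≈id , ι∘q≈id
    where
    ι∘q≈id : ι (proj₁ X) ∘ arr q ≈ id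
    ι∘q≈id = ≈-trans (refl⟩∘⟨ left-inverse-unique (ι-iso (proj₁ X)) q∘ι≈id) (ι∘ι⁻¹ (proj₁ X))

    q-isoN : IsIso N {TN₀ X} {X} q
    q-isoN = conservative q (ι (proj₁ X) , ι∘q≈id , q∘ι≈id)

    ι∈N : isHom (ι (proj₁ X))
    ι∈N = ≈-closed (≈-sym (left-inverse-unique (N-iso⇒M-iso {f = q} q-isoN) ι∘q≈id))
                   (SHom.inS (proj₁ q-isoN))

  -- an M-monic N-subobject of a strongly Cantorian object is strongly Cantorian,
  -- because ι⁻¹ ∘ T n ≈ n ∘ ι⁻¹ puts ι⁻¹ into N by factor
  scan-subobject : ∀ {S X : NObj} (n : S ⇒N X) → Mono M (arr n) → isSCan X → isSCan S
  scan-subobject {S} n n-mono sX =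
    scan-from-retraction S (ι⁻¹ (proj₁ S) ,ₕ ι⁻¹∈N) (ι⁻¹∘ι (proj₁ S))
    where
    ι⁻¹∈N : isHom (ι⁻¹ (proj₁ S))
    ι⁻¹∈N = factor n (ι⁻¹N sX ∘N TN₁ n) n-mono (ι⁻¹ (proj₁ S))
                   (iso-shift (ι⁻¹N∘T∘ι sX (arr n)) (ι∘ι⁻¹ (proj₁ S)))

  scan-product : ∀ {X Y : NObj} → isSCan X → isSCan Y → isSCan (X ×N Y)
  scan-product {X} {Y} sX sY =
    scan-from-retraction (X ×N Y) q (×-ext _ _ component-π₁ component-π₂)
    where
    q : TN₀ (X ×N Y) ⇒N (X ×N Y)
    q = ⟨ ι⁻¹N sX ∘N TN₁ π₁N , ι⁻¹N sY ∘N TN₁ π₂N ⟩N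

    component-π₁ : π₁ ∘ (arr q ∘ ι (proj₁ (X ×N Y))) ≈ π₁ ∘ id
    component-π₁ = begin
      π₁ ∘ (arr q ∘ ι _)                     ≈⟨ sym-assoc ⟩
      (π₁ ∘ arr q) ∘ ι _                     ≈⟨ π₁∘⟨⟩N _ _ ⟩∘⟨refl ⟩
      (arr (ι⁻¹N sX) ∘ T₁ π₁) ∘ ι _          ≈⟨ ι⁻¹N∘T∘ι sX π₁ ⟩
      π₁                                     ≈⟨ identityʳ ⟨
      π₁ ∘ id                                ∎

    component-π₂ : π₂ ∘ (arr q ∘ ι (proj₁ (X ×N Y))) ≈ π₂ ∘ id
    component-π₂ = begin
      π₂ ∘ (arr q ∘ ι _)                     ≈⟨ sym-assoc ⟩
      (π₂ ∘ arr q) ∘ ι _                     ≈⟨ π₂∘⟨⟩N _ _ ⟩∘⟨refl ⟩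
      (arr (ι⁻¹N sY) ∘ T₁ π₂) ∘ ι _          ≈⟨ ι⁻¹N∘T∘ι sY π₂ ⟩
      π₂                                     ≈⟨ identityʳ ⟨
      π₂ ∘ id                                ∎

  scan-T : ∀ {X : NObj} → isSCan X → isSCan (TN₀ X)
  scan-T {X} sX = scan-from-retraction (TN₀ X) (TN₁ (ι⁻¹N sX))
    (≈-trans (ι-natural (arr (ι⁻¹N sX))) (ι∘ι⁻¹N sX))

  -- the pullback in N of a cospan of strongly Cantorian objects is strongly
  -- Cantorian: its legs pair to an M-mono into a product
  scan-pullback : ∀ {X Y V : NObj} (f : X ⇒N V) (g : Y ⇒N V) →
                  isSCan X → isSCan Y → isSCan (NPullback.W f g)
  scan-pullback f g sX sY =
    scan-subobject ⟨ w₁ , w₂ ⟩N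
      (jointly-monic-components (π₁∘⟨⟩N w₁ w₂) (π₂∘⟨⟩N w₁ w₂) (pullback-jointly-monic isPullbackM))
      (scan-product sX sY)
    where open NPullback f g

  -- monomorphisms of SCan are monic in M: the kernel pair of r lies in
  -- SCan, so its two legs agree
  scan-mono⇒mono : ∀ {R Y : SObj} (r : R ⇒S Y) → Mono SCan {R} {Y} r → Mono M (arr r)
  scan-mono⇒mono {R} r r-mono x y r∘x≈r∘y =
    let (h , (w₁∘h≈x , w₂∘h≈y) , _) = proj₂ isPullbackM x y r∘x≈r∘y
    in begin
      x           ≈⟨ w₁∘h≈x ⟨
      arr w₁ ∘ h  ≈⟨ legs-equal ⟩∘⟨refl ⟩
      arr w₂ ∘ h  ≈⟨ w₂∘h≈y ⟩
      y           ∎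
    where
    open NPullback r r
    legs-equal : arr w₁ ≈ arr w₂
    legs-equal = r-mono {W , scan-pullback r r (proj₂ R) (proj₂ R)} w₁ w₂ (proj₁ isPullbackM)

  -- a pullback square of SCan whose leg p is M-monic is a pullback in M:
  -- an M-cone factors through the (strongly Cantorian) N-pullback
  scan-pullback⇒pullback : ∀ {X Y V W : SObj} {f : X ⇒S V} {g : Y ⇒S V}
                             {p : W ⇒S X} {q : W ⇒S Y} →
    Mono M (arr p) → IsPullback SCan {X} {Y} {V} {W} f g p q →
    IsPullback M (arr f) (arr g) (arr p) (arr q)
  scan-pullback⇒pullback {X} {Y} {W = W} {f = f} {g} {p} {q} p-mono (f∘p≈g∘q , universal) =
    f∘p≈g∘q , λ a b f∘a≈g∘b →
      let (u , (w₁∘u≈a , w₂∘u≈b) , _) = proj₂ isPullbackM a b f∘a≈g∘b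
          p∘vu≈a : arr p ∘ (arr v ∘ u) ≈ a
          p∘vu≈a = ≈-trans sym-assoc (≈-trans (p∘v≈w₁ ⟩∘⟨refl) w₁∘u≈a)
      in (arr v ∘ u) ,
         (p∘vu≈a , ≈-trans sym-assoc (≈-trans (q∘v≈w₂ ⟩∘⟨refl) w₂∘u≈b)) ,
         λ h p∘h≈a _ → p-mono h (arr v ∘ u) (≈-trans p∘h≈a (≈-sym p∘vu≈a))
    where
    open NPullback f g renaming (W to PB)

    comparison : Σ (PB ⇒N proj₁ W) λ v →
                   ((arr p ∘ arr v ≈ arr w₁) × (arr q ∘ arr v ≈ arr w₂)) ×
                   (∀ (v' : PB ⇒N proj₁ W) → arr p ∘ arr v' ≈ arr w₁ →
                      arr q ∘ arr v' ≈ arr w₂ → arr v' ≈ arr v)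
    comparison = universal {PB , scan-pullback f g (proj₂ X) (proj₂ Y)} w₁ w₂ (proj₁ isPullbackM)

    v : PB ⇒N proj₁ W
    v = proj₁ comparison

    p∘v≈w₁ : arr p ∘ arr v ≈ arr w₁
    p∘v≈w₁ = proj₁ (proj₁ (proj₂ comparison))

    q∘v≈w₂ : arr q ∘ arr v ≈ arr w₂
    q∘v≈w₂ = proj₂ (proj₁ (proj₂ comparison))

  -- conversely, an M-pullback square of SCan-morphisms with M-monic leg p
  -- is a pullback in SCan: mediating maps lie in N by factor
  pullback⇒scan-pullback : ∀ {X Y V W : SObj} {f : X ⇒S V} {g : Y ⇒S V}
                             {p : W ⇒S X} {q : W ⇒S Y} →
    Mono M (arr p) → IsPullback M (arr f) (arr g) (arr p) (arr q) →
    IsPullback SCan {X} {Y} {V} {W} f g p q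
  pullback⇒scan-pullback {p = p} p-mono (f∘p≈g∘q , universal) =
    f∘p≈g∘q , λ a b f∘a≈g∘b →
      let (h , (p∘h≈a , q∘h≈b) , unique) = universal (arr a) (arr b) f∘a≈g∘b
      in (h ,ₕ factor p a p-mono h (≈-sym p∘h≈a)) , (p∘h≈a , q∘h≈b) ,
         λ h' → unique (arr h')

  module AtSCanObject {A : NObj} (sA : isSCan A) where

    m : proj₁ (⊆T A) ⇒ proj₁ (TN₀ A ×N P₀ A)
    m = arr (m⊆ A)

    Classifies : ∀ (B : NObj) {R : NObj} → proj₁ B ⇒ proj₁ (P₀ A) → R ⇒N (TN₀ A ×N B) →
                 Set (o ⊔ ℓ ⊔ e)
    Classifies B χ' r = PullbackAlongId× M π₁ π₂ π₁ π₂ m χ' (arr r)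

    UniqueClassifier : ∀ (B : NObj) {R : NObj} → R ⇒N (TN₀ A ×N B) → Set (o ⊔ ℓ ⊔ e ⊔ p)
    UniqueClassifier B r =
      Σ (B ⇒N P₀ A) λ χ → Classifies B (arr χ) r × (∀ χ' → Classifies B χ' r → χ' ≈ arr χ)

    E₀ P₀A : Obj
    E₀ = proj₁ (⊆T A)
    P₀A = proj₁ (P₀ A)

    id×ι : proj₁ (TN₀ A ×N P₀ A) ⇒ proj₁ (TN₀ A ×N TN₀ (P₀ A))
    id×ι = ⟨ id ∘ π₁ , ι P₀A ∘ π₂ ⟩M

    id×ι-inverse : ∀ {k : proj₁ (TN₀ A ×N TN₀ (P₀ A)) ⇒ proj₁ (TN₀ A ×N P₀ A)} →
                   π₁ ∘ k ≈ id ∘ π₁ → π₂ ∘ k ≈ ι⁻¹ P₀A ∘ π₂ →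
                   (k ∘ id×ι ≈ id) × (id×ι ∘ k ≈ id)
    id×ι-inverse k₁ k₂ =
      product-maps-inverse ×-ext (π₁∘⟨⟩M _ _) (π₂∘⟨⟩M _ _) k₁ k₂ identityˡ (ι⁻¹∘ι P₀A) ,
      product-maps-inverse ×-ext k₁ k₂ (π₁∘⟨⟩M _ _) (π₂∘⟨⟩M _ _) identityˡ (ι∘ι⁻¹ P₀A)

    id×ι-mono : Mono M id×ι
    id×ι-mono =
      section⇒mono (proj₁ (id×ι-inverse {⟨ id ∘ π₁ , ι⁻¹ P₀A ∘ π₂ ⟩M} (π₁∘⟨⟩M _ _) (π₂∘⟨⟩M _ _)))

    Tm : TN₀ (⊆T A) ⇒N (TN₀ A ×N TN₀ (P₀ A))
    Tm = ⟨ TN₁ (ι⁻¹N sA ∘N (π₁N ∘N m⊆ A)) , TN₁ (π₂N ∘N m⊆ A) ⟩N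

    -- by naturality of ι, Tm is id × ι_{PA} applied to m, up to the iso ι_{⊆ᵀ_A}
    Tm∘ι≈id×ι∘m : arr Tm ∘ ι E₀ ≈ id×ι ∘ m
    Tm∘ι≈id×ι∘m = ×-ext _ _
      (begin
        π₁ ∘ (arr Tm ∘ ι E₀)                  ≈⟨ sym-assoc ⟩
        (π₁ ∘ arr Tm) ∘ ι E₀                  ≈⟨ π₁∘⟨⟩N _ _ ⟩∘⟨refl ⟩
        T₁ (arr (ι⁻¹N sA) ∘ (π₁ ∘ m)) ∘ ι E₀  ≈⟨ ι-natural _ ⟩
        ι _ ∘ (arr (ι⁻¹N sA) ∘ (π₁ ∘ m))      ≈⟨ cancelˡ (ι∘ι⁻¹N sA) ⟩
        π₁ ∘ m                                ≈⟨ identityˡ ⟩∘⟨refl ⟨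
        (id ∘ π₁) ∘ m                         ≈⟨ π₁∘⟨⟩M _ _ ⟩∘⟨refl ⟨
        (π₁ ∘ id×ι) ∘ m                       ≈⟨ assoc ⟩
        π₁ ∘ (id×ι ∘ m)                       ∎)
      (begin
        π₂ ∘ (arr Tm ∘ ι E₀)                  ≈⟨ sym-assoc ⟩
        (π₂ ∘ arr Tm) ∘ ι E₀                  ≈⟨ π₂∘⟨⟩N _ _ ⟩∘⟨refl ⟩
        T₁ (π₂ ∘ m) ∘ ι E₀                    ≈⟨ ι-natural _ ⟩
        ι P₀A ∘ (π₂ ∘ m)                      ≈⟨ sym-assoc ⟩
        (ι P₀A ∘ π₂) ∘ m                      ≈⟨ π₂∘⟨⟩M _ _ ⟩∘⟨refl ⟨
        (π₂ ∘ id×ι) ∘ m                       ≈⟨ assoc ⟩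
        π₂ ∘ (id×ι ∘ m)                       ∎)

    Tm≈id×ι∘m∘ι⁻¹ : arr Tm ≈ (id×ι ∘ m) ∘ ι⁻¹ E₀
    Tm≈id×ι∘m∘ι⁻¹ = iso-shift Tm∘ι≈id×ι∘m (ι∘ι⁻¹ E₀)

    Tm-mono : Mono M (arr Tm)
    Tm-mono = mono-resp-≈ (≈-sym Tm≈id×ι∘m∘ι⁻¹)
      (mono-∘ (mono-∘ id×ι-mono (m⊆-mono A)) (section⇒mono (ι∘ι⁻¹ E₀)))

    -- hence Tm is classified by ι_{PA}⁻¹: the square k ∘ Tm ≈ m ∘ ι_{⊆ᵀ_A}⁻¹
    -- has an invertible leg k = id × ι_{PA}⁻¹ and an invertible leg ι⁻¹
    ι⁻¹-classifies-Tm : Classifies (TN₀ (P₀ A)) (ι⁻¹ P₀A) Tm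
    ι⁻¹-classifies-Tm k k₁ k₂ =
      ι⁻¹ E₀ ,
      iso-square-pullback (section⇒mono (proj₂ k-inverse)) (ι∘ι⁻¹ E₀) (ι⁻¹∘ι E₀)
        (≈-trans (refl⟩∘⟨ Tm≈id×ι∘m∘ι⁻¹) (≈-trans (refl⟩∘⟨ assoc) (cancelˡ (proj₁ k-inverse))))
      where
      k-inverse : (k ∘ id×ι ≈ id) × (id×ι ∘ k ≈ id)
      k-inverse = id×ι-inverse (≈-trans k₁ (≈-sym identityˡ)) k₂

    -- P A is strongly Cantorian: by uniqueness of classifying maps, ι_{PA}⁻¹
    -- equals the classifying map of Tm, an N-morphism
    scan-P : isSCan (P₀ A)
    scan-P = scan-from-retraction (P₀ A) χ χ∘ι≈id
      where
      classification : UniqueClassifier (TN₀ (P₀ A)) Tm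
      classification = m⊆-universal A (TN₀ (P₀ A)) (TN₀ (⊆T A)) Tm Tm-mono

      χ : TN₀ (P₀ A) ⇒N P₀ A
      χ = proj₁ classification

      χ∘ι≈id : arr χ ∘ ι P₀A ≈ id
      χ∘ι≈id = ≈-trans (≈-sym (proj₂ (proj₂ classification) (ι⁻¹ P₀A) ι⁻¹-classifies-Tm) ⟩∘⟨refl)
                       (ι⁻¹∘ι P₀A)

    scan-E : isSCan (⊆T A)
    scan-E = scan-subobject (m⊆ A) (m⊆-mono A) (scan-product (scan-T sA) scan-P)

    scan-A×P : isSCan (A ×N P₀ A)
    scan-A×P = scan-product sA scan-P

    ι×id : (A ×N P₀ A) ⇒N (TN₀ A ×N P₀ A)
    ι×id = ⟨ ιN sA ∘N π₁N , π₂N ⟩N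

    -- The membership relation of A in SCan is m transported along ι_A × id,
    -- i.e. any ε with (ι_A × id) ∘ ε ≈ m; this is the statement's description
    -- of ε by its two components.
    ε-spec : ∀ (j : Functor.F₀ T (proj₁ A) ⇒ proj₁ A) → ι (proj₁ A) ∘ j ≈ id →
             (ε : proj₁ (⊆T A) ⇒ proj₁ (A ×N P₀ A)) →
             π₁ ∘ ε ≈ j ∘ (π₁ ∘ m) → π₂ ∘ ε ≈ π₂ ∘ m → arr ι×id ∘ ε ≈ m
    ε-spec j ι∘j≈id ε π₁∘ε≈ π₂∘ε≈ = ×-ext _ _
      (begin
        π₁ ∘ (arr ι×id ∘ ε)       ≈⟨ sym-assoc ⟩
        (π₁ ∘ arr ι×id) ∘ ε       ≈⟨ π₁∘⟨⟩N _ _ ⟩∘⟨refl ⟩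
        (ι _ ∘ π₁) ∘ ε            ≈⟨ assoc ⟩
        ι _ ∘ (π₁ ∘ ε)            ≈⟨ refl⟩∘⟨ π₁∘ε≈ ⟩
        ι _ ∘ (j ∘ (π₁ ∘ m))      ≈⟨ cancelˡ ι∘j≈id ⟩
        π₁ ∘ m                    ∎)
      (begin
        π₂ ∘ (arr ι×id ∘ ε)       ≈⟨ sym-assoc ⟩
        (π₂ ∘ arr ι×id) ∘ ε       ≈⟨ π₂∘⟨⟩N _ _ ⟩∘⟨refl ⟩
        π₂ ∘ ε                    ≈⟨ π₂∘ε≈ ⟩
        π₂ ∘ m                    ∎)

    SA SP SE SX : SObj
    SA = A , sA
    SP = P₀ A , scan-P
    SE = ⊆T A , scan-E
    SX = A ×N P₀ A , scan-A×P

    module PowerObject (ε : proj₁ (⊆T A) ⇒ proj₁ (A ×N P₀ A))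
                       (ι×id∘ε≈m : arr ι×id ∘ ε ≈ m) where

      ι×id⁻¹ : (TN₀ A ×N P₀ A) ⇒N (A ×N P₀ A)
      ι×id⁻¹ = ⟨ ι⁻¹N sA ∘N π₁N , π₂N ⟩N

      ι×id⁻¹∘ι×id≈id : arr ι×id⁻¹ ∘ arr ι×id ≈ id
      ι×id⁻¹∘ι×id≈id = product-maps-inverse ×-ext
        (π₁∘⟨⟩N _ _) (≈-trans (π₂∘⟨⟩N _ _) (≈-sym identityˡ))
        (π₁∘⟨⟩N _ _) (≈-trans (π₂∘⟨⟩N _ _) (≈-sym identityˡ))
        (ι⁻¹N∘ι sA) identityˡ

      ι×id-mono : Mono M (arr ι×id)
      ι×id-mono = section⇒mono ι×id⁻¹∘ι×id≈id

      ε∈N : isHom ε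
      ε∈N = ≈-closed (≈-trans (refl⟩∘⟨ ≈-sym ι×id∘ε≈m) (cancelˡ ι×id⁻¹∘ι×id≈id))
                     (SHom.inS (ι×id⁻¹ ∘N m⊆ A))

      εS : SE ⇒S SX
      εS = ε ,ₕ ε∈N

      ε-mono : Mono M ε
      ε-mono = mono-factor ι×id∘ε≈m (m⊆-mono A)

      -- Classifying a subobject r : R ↣ Y of a product Y of A and B in SCan:
      -- φ = ι_A × id : Y ≅ TA × B turns r into an M-monic N-relation r' of the
      -- form required by m⊆-universal, whose classifying map χ is the answer.
      module Classification {B Y R : SObj} (q₁ : Y ⇒S SA) (q₂ : Y ⇒S B)
                            (Y-product : IsProduct SCan {SA} {B} {Y} q₁ q₂)
                            (r : R ⇒S Y) (r-mono : Mono SCan {R} {Y} r) where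

        TA×B : SObj
        TA×B = TN₀ A ×N proj₁ B , scan-product (scan-T sA) (proj₂ B)

        φ : Y ⇒S TA×B
        φ = ⟨ ιN sA ∘N q₁ , q₂ ⟩N

        φ⁻¹-data : Σ (TA×B ⇒S Y) λ h →
                     ((arr q₁ ∘ arr h ≈ arr (ι⁻¹N sA) ∘ π₁) × (arr q₂ ∘ arr h ≈ π₂)) ×
                     (∀ (h' : TA×B ⇒S Y) → arr q₁ ∘ arr h' ≈ arr (ι⁻¹N sA) ∘ π₁ →
                        arr q₂ ∘ arr h' ≈ π₂ → arr h' ≈ arr h)
        φ⁻¹-data = Y-product {TA×B} (ι⁻¹N sA ∘N π₁N) π₂N

        φ⁻¹ : TA×B ⇒S Y
        φ⁻¹ = proj₁ φ⁻¹-data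

        q₁∘φ⁻¹ : arr q₁ ∘ arr φ⁻¹ ≈ arr (ι⁻¹N sA) ∘ π₁
        q₁∘φ⁻¹ = proj₁ (proj₁ (proj₂ φ⁻¹-data))

        q₂∘φ⁻¹ : arr q₂ ∘ arr φ⁻¹ ≈ id ∘ π₂
        q₂∘φ⁻¹ = ≈-trans (proj₂ (proj₁ (proj₂ φ⁻¹-data))) (≈-sym identityˡ)

        π₂∘φ : π₂ ∘ arr φ ≈ id ∘ arr q₂
        π₂∘φ = ≈-trans (π₂∘⟨⟩N _ _) (≈-sym identityˡ)

        φ⁻¹∘φ≈id : arr φ⁻¹ ∘ arr φ ≈ id
        φ⁻¹∘φ≈id = S.product-ext {Y} {SA} {B} {q₁} {q₂} (λ {Z} → Y-product {Z})
          {Y} (φ⁻¹ ∘N φ) (Category.id N)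
          (component-inverse (π₁∘⟨⟩N _ _) q₁∘φ⁻¹ (ι⁻¹N∘ι sA))
          (component-inverse π₂∘φ q₂∘φ⁻¹ identityˡ)

        φ∘φ⁻¹≈id : arr φ ∘ arr φ⁻¹ ≈ id
        φ∘φ⁻¹≈id = product-maps-inverse ×-ext
          q₁∘φ⁻¹ q₂∘φ⁻¹ (π₁∘⟨⟩N _ _) π₂∘φ (ι∘ι⁻¹N sA) identityˡ

        r-monoM : Mono M (arr r)
        r-monoM = scan-mono⇒mono {R} {Y} r (λ {Z} → r-mono {Z})

        r' : proj₁ R ⇒N proj₁ TA×B
        r' = φ ∘N r

        r'-mono : Mono M (arr r')
        r'-mono = mono-∘ (section⇒mono φ⁻¹∘φ≈id) r-monoM

        classification : UniqueClassifier (proj₁ B) r'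
        classification = m⊆-universal A (proj₁ B) (proj₁ R) r' r'-mono

        χ : proj₁ B ⇒N P₀ A
        χ = proj₁ classification

        id×-relation : ∀ (χ' : proj₁ B ⇒N P₀ A)
                         {k : proj₁ (proj₁ Y) ⇒ proj₁ (A ×N P₀ A)}
                         {k' : proj₁ (TN₀ A ×N proj₁ B) ⇒ proj₁ (TN₀ A ×N P₀ A)} →
                       π₁ ∘ k ≈ arr q₁ → π₂ ∘ k ≈ arr χ' ∘ arr q₂ →
                       π₁ ∘ k' ≈ π₁ → π₂ ∘ k' ≈ arr χ' ∘ π₂ →
                       k' ∘ arr φ ≈ arr ι×id ∘ k
        id×-relation χ' {k} {k'} k₁ k₂ k'₁ k'₂ = ×-ext _ _
          (begin
            π₁ ∘ (k' ∘ arr φ)       ≈⟨ sym-assoc ⟩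
            (π₁ ∘ k') ∘ arr φ       ≈⟨ k'₁ ⟩∘⟨refl ⟩
            π₁ ∘ arr φ              ≈⟨ π₁∘⟨⟩N _ _ ⟩
            ι _ ∘ arr q₁            ≈⟨ refl⟩∘⟨ k₁ ⟨
            ι _ ∘ (π₁ ∘ k)          ≈⟨ sym-assoc ⟩
            (ι _ ∘ π₁) ∘ k          ≈⟨ π₁∘⟨⟩N _ _ ⟩∘⟨refl ⟨
            (π₁ ∘ arr ι×id) ∘ k     ≈⟨ assoc ⟩
            π₁ ∘ (arr ι×id ∘ k)     ∎)
          (begin
            π₂ ∘ (k' ∘ arr φ)       ≈⟨ sym-assoc ⟩
            (π₂ ∘ k') ∘ arr φ       ≈⟨ k'₂ ⟩∘⟨refl ⟩
            (arr χ' ∘ π₂) ∘ arr φ   ≈⟨ assoc ⟩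
            arr χ' ∘ (π₂ ∘ arr φ)   ≈⟨ refl⟩∘⟨ π₂∘⟨⟩N _ _ ⟩
            arr χ' ∘ arr q₂         ≈⟨ k₂ ⟨
            π₂ ∘ k                  ≈⟨ π₂∘⟨⟩N _ _ ⟩∘⟨refl ⟨
            (π₂ ∘ arr ι×id) ∘ k     ≈⟨ assoc ⟩
            π₂ ∘ (arr ι×id ∘ k)     ∎)

        -- χ classifies r in SCan: the M-pullback square for r' is carried
        -- back along φ and ι_A × id, and then lies in SCan
        χ-classifies : PullbackAlongId× SCan {SA} {SP} {B} {SX} {Y} {SE} {R}
                         π₁N π₂N q₁ q₂ εS χ r
        χ-classifies k k₁ k₂ =
          let (g , pb) = proj₁ (proj₂ classification) (arr k') (π₁∘⟨⟩N _ _) (π₂∘⟨⟩N _ _)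
              g∈N = factor (m⊆ A) (k' ∘N r') (m⊆-mono A) g (proj₁ pb)
          in (g ,ₕ g∈N) ,
             pullback⇒scan-pullback {Y} {SE} {SX} {R} {k} {εS} {r} {g ,ₕ g∈N} r-monoM
               (pullback-untransport φ⁻¹∘φ≈id φ∘φ⁻¹≈id ι×id-mono
                  (id×-relation χ k₁ k₂ (π₁∘⟨⟩N _ _) (π₂∘⟨⟩N _ _)) (≈-sym ι×id∘ε≈m) pb)
          where
          k' : (TN₀ A ×N proj₁ B) ⇒N (TN₀ A ×N P₀ A)
          k' = ⟨ π₁N , χ ∘N π₂N ⟩N

        -- any χ' classifying r in SCan classifies r' in M, hence equals χ
        χ-unique : ∀ (χ' : proj₁ B ⇒N P₀ A) →
                   PullbackAlongId× SCan {SA} {SP} {B} {SX} {Y} {SE} {R} π₁N π₂N q₁ q₂ εS χ' r →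
                   arr χ' ≈ arr χ
        χ-unique χ' χ'-classifies = proj₂ (proj₂ classification) (arr χ') classifies-r'
          where
          k : proj₁ Y ⇒N (A ×N P₀ A)
          k = ⟨ q₁ , χ' ∘N q₂ ⟩N

          classifies-r' : Classifies (proj₁ B) (arr χ') r'
          classifies-r' k' k'₁ k'₂ =
            let (g , pb) = χ'-classifies k (π₁∘⟨⟩N _ _) (π₂∘⟨⟩N _ _)
            in arr g ,
               pullback-transport φ⁻¹∘φ≈id φ∘φ⁻¹≈id ι×id-mono
                 (id×-relation χ' (π₁∘⟨⟩N _ _) (π₂∘⟨⟩N _ _) k'₁ k'₂) (≈-sym ι×id∘ε≈m)
                 (scan-pullback⇒pullback {Y} {SE} {SX} {R} {k} {εS} {r} {g} r-monoM pb)

      is-power-object : Σ (isHom ε) λ εN → IsPowerObject SCan {SA} {SP} {SE} {SX} π₁N π₂N (ε ,ₕ εN)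
      is-power-object =
        ε∈N , (λ {Z} → productN A (P₀ A) {proj₁ Z}) , (λ g h → ε-mono (arr g) (arr h)) ,
        λ {B} {Y} {R} q₁ q₂ Y-product r r-mono →
          let open Classification {B} {Y} {R} q₁ q₂ (λ {Z} → Y-product {Z})
                                  r (λ {Z} → r-mono {Z})
          in χ , χ-classifies , χ-unique

mainTheorem8 : ∀ {o ℓ e p} (I : IMLU o ℓ e p) →
    let open IMLU I in
    let open Category M in
    ∀ (A : Category.Obj SCan) →
    Σ (isSCan (Functor.F₀ P (proj₁ A))) λ sP →
    Σ (isSCan (⊆T (proj₁ A))) λ sE →
    Σ (isSCan (proj₁ A ×N Functor.F₀ P (proj₁ A))) λ sX →
    ∀ (j : Functor.F₀ T (proj₁ (proj₁ A)) ⇒ proj₁ (proj₁ A)) →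
    j ∘ ι (proj₁ (proj₁ A)) ≈ id →
    ι (proj₁ (proj₁ A)) ∘ j ≈ id →
    ∀ (ε : proj₁ (⊆T (proj₁ A)) ⇒ proj₁ (proj₁ A ×N Functor.F₀ P (proj₁ A))) →
    SHom.arr (π₁N {proj₁ A} {Functor.F₀ P (proj₁ A)}) ∘ ε
    ≈ j ∘ (SHom.arr (π₁N {Functor.F₀ TN (proj₁ A)} {Functor.F₀ P (proj₁ A)})
    ∘ SHom.arr (m⊆ (proj₁ A))) →
    SHom.arr (π₂N {proj₁ A} {Functor.F₀ P (proj₁ A)}) ∘ ε
    ≈ SHom.arr (π₂N {Functor.F₀ TN (proj₁ A)} {Functor.F₀ P (proj₁ A)})
    ∘ SHom.arr (m⊆ (proj₁ A)) →
    Σ (isHom ε) λ εN →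
    IsPowerObject SCan {A} {Functor.F₀ P (proj₁ A) , sP} {⊆T (proj₁ A) , sE}
    {(proj₁ A ×N Functor.F₀ P (proj₁ A)) , sX}
    (π₁N {proj₁ A} {Functor.F₀ P (proj₁ A)})
    (π₂N {proj₁ A} {Functor.F₀ P (proj₁ A)})
    (ε ,ₕ εN)
mainTheorem8 I A =
  scan-P , scan-E , scan-A×P ,
  λ j _ ι∘j≈id ε π₁∘ε≈ π₂∘ε≈ →
    PowerObject.is-power-object ε (ε-spec j ι∘j≈id ε π₁∘ε≈ π₂∘ε≈)
  where
  open IMLUFacts I
  open AtSCanObject (proj₂ A)
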